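{- A finite tree $T$ has an ASBG-colouring if and only if its reduced form is (isomorphic to) the path $P_2$ on two vertices, and in that case the ASBG-colouring of $T$ is unique.
   Context: A colouring of a graph $G$ is a map $c:E(G)\to\{\text{blue},\text{red}\}$. An alternating signed bipartite graph (ASBG) is a bipartite graph with no isolated vertices and edges coloured blue and red, for which there is a linear ordering of the vertices such that for every vertex $u$ with neighbours listed in this order as $v_1,\dots,v_k$, the edges $uv_1,\dots,uv_k$ alternate in colour, starting and ending with blue. An ASBG-colouring of $G$ is a colouring $c$ such that $G$ with these colours is an ASBG. A leaf is a vertex of degree $1$. A twig is a vertex $b$ of degree $3$ (the base) together with two leaves adjacent to $b$. A leaf-twig configuration at a vertex $v$ consists of four vertices distinct from $v$: a leaf $\ell$ and a twig with base $b$, where $\ell$ and $b$ are both adjacent to $v$; removing it means deleting these four vertices and their four incident edges. The reduced form of $G$ is the graph obtained by repeatedly removing leaf-twig configurations until none remain. -}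

module Defs where

open import Data.Nat using (ℕ; zero; suc; _+_; _≤_; _<_)
open import Data.Bool using (Bool; true; false; not)
open import Data.Fin using (Fin; zero; suc; inject₁; fromℕ; _≟_)
open import Data.List using (List; []; _∷_; map; filterᵇ; length; allFin; tabulate)
open import Data.Product using (Σ; Σ-syntax; ∃; ∃-syntax; _×_; _,_)
open import Data.Empty using (⊥)
open import Relation.Nullary using (¬_)
open import Relation.Nullary.Decidable using (⌊_⌋)
open import Relation.Binary.PropositionalEquality using (_≡_; _≢_)
open import Relation.Binary.Construct.Closure.ReflexiveTransitive using (Star)
open import Function.Bundles using (_↔_; Inverse)
open import Function.Definitions using (Injective)
open import Data.Fin.Permutation using (Permutation′; _⟨$⟩ʳ_)

record Graph : Set where
  field
    n     : ℕ
    adj   : Fin n → Fin n → Bool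
    sym   : ∀ u v → adj u v ≡ adj v u
    irr   : ∀ v → adj v v ≡ false

open Graph public

Edge : (G : Graph) → Fin (n G) → Fin (n G) → Set
Edge G u v = adj G u v ≡ true

neighbours : (G : Graph) → Fin (n G) → List (Fin (n G))
neighbours G u = filterᵇ (adj G u) (allFin (n G))

deg : (G : Graph) → Fin (n G) → ℕ
deg G u = length (neighbours G u)

IsLeaf : (G : Graph) → Fin (n G) → Set
IsLeaf G v = deg G v ≡ 1

data Walk (G : Graph) : Fin (n G) → Fin (n G) → Set where
  here : ∀ {u} → Walk G u u
  step : ∀ {u w v} → Edge G u w → Walk G w v → Walk G u v

Connected : Graph → Set
Connected G = ∀ u v → Walk G u v

record Cycle (G : Graph) : Set where
  field
    m      : ℕ
    c      : Fin (3 + m) → Fin (n G)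
    inj    : Injective _≡_ _≡_ c
    consec : ∀ (i : Fin (2 + m)) → Edge G (c (inject₁ i)) (c (suc i))
    close  : Edge G (c (fromℕ (2 + m))) (c zero)

Acyclic : Graph → Set
Acyclic G = ¬ Cycle G

IsTree : Graph → Set
IsTree G = (1 ≤ n G) × Connected G × Acyclic G

data Colour : Set where
  blue red : Colour

record Colouring (G : Graph) : Set where
  field
    col  : Fin (n G) → Fin (n G) → Colour
    csym : ∀ u v → Edge G u v → col u v ≡ col v u

open Colouring public

data AltBlue : List Colour → Set where
  single : AltBlue (blue ∷ [])
  more   : ∀ {cs} → AltBlue cs → AltBlue (blue ∷ red ∷ cs)

Bipartite : Graph → Set
Bipartite G = Σ[ side ∈ (Fin (n G) → Bool) ] (∀ u v → Edge G u v → side u ≢ side v)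

NoIsolated : Graph → Set
NoIsolated G = ∀ u → ∃[ v ] Edge G u v

-- neighbours of u listed according to the linear order given by π
-- (π maps position i to the i-th vertex of the ordering)
neighboursIn : (G : Graph) → Permutation′ (n G) → Fin (n G) → List (Fin (n G))
neighboursIn G π u = filterᵇ (adj G u) (tabulate (π ⟨$⟩ʳ_))

IsASBGColouring : (G : Graph) → Colouring G → Set
IsASBGColouring G c =
  Bipartite G × NoIsolated G ×
  Σ[ π ∈ Permutation′ (n G) ] (∀ u → AltBlue (map (col c u) (neighboursIn G π u)))

HasASBGColouring : Graph → Set
HasASBGColouring G = Σ[ c ∈ Colouring G ] IsASBGColouring G c

record LeafTwig (G : Graph) (v : Fin (n G)) : Set where
  field
    ℓ b l₁ l₂ : Fin (n G)
    ℓ≢v : ℓ ≢ v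
    b≢v : b ≢ v
    l₁≢v : l₁ ≢ v
    l₂≢v : l₂ ≢ v
    ℓ≢b : ℓ ≢ b
    ℓ≢l₁ : ℓ ≢ l₁
    ℓ≢l₂ : ℓ ≢ l₂
    b≢l₁ : b ≢ l₁
    b≢l₂ : b ≢ l₂
    l₁≢l₂ : l₁ ≢ l₂
    ℓ-leaf : IsLeaf G ℓ
    ℓv : Edge G ℓ v
    bv : Edge G b v
    b-deg3 : deg G b ≡ 3
    l₁-leaf : IsLeaf G l₁
    l₂-leaf : IsLeaf G l₂
    bl₁ : Edge G b l₁
    bl₂ : Edge G b l₂

InConfig : ∀ {G v} → LeafTwig G v → Fin (n G) → Set
InConfig C w = (w ≡ LeafTwig.ℓ C) Data.Sum.⊎ ((w ≡ LeafTwig.b C) Data.Sum.⊎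
               ((w ≡ LeafTwig.l₁ C) Data.Sum.⊎ (w ≡ LeafTwig.l₂ C)))
  where import Data.Sum

-- H is (isomorphic to) the graph obtained from G by removing the
-- leaf-twig configuration C, i.e. the subgraph induced on the other vertices:
-- e embeds H into G injectively, onto exactly the vertices outside C,
-- preserving and reflecting adjacency.
record RemovalOf (G : Graph) {v} (C : LeafTwig G v) (H : Graph) : Set where
  field
    e     : Fin (n H) → Fin (n G)
    e-inj : Injective _≡_ _≡_ e
    e-out : ∀ i → ¬ InConfig C (e i)
    e-onto : ∀ w → ¬ InConfig C w → ∃[ i ] e i ≡ w
    e-adj : ∀ i j → adj H i j ≡ adj G (e i) (e j)

RemoveStep : Graph → Graph → Set
RemoveStep G H = Σ[ v ∈ Fin (n G) ] Σ[ C ∈ LeafTwig G v ] RemovalOf G C H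

HasNoLeafTwig : Graph → Set
HasNoLeafTwig G = ∀ v → ¬ LeafTwig G v

IsReducedForm : Graph → Graph → Set
IsReducedForm G R = Star RemoveStep G R × HasNoLeafTwig R

record _≅_ (G H : Graph) : Set where
  field
    f     : Fin (n G) ↔ Fin (n H)
    f-adj : ∀ u v → adj G u v ≡ adj H (Inverse.to f u) (Inverse.to f v)

P₂adj : Fin 2 → Fin 2 → Bool
P₂adj u v = not ⌊ u ≟ v ⌋

P₂ : Graph
P₂ = record { n = 2 ; adj = P₂adj ; sym = s ; irr = i }
  where
  s : ∀ u v → P₂adj u v ≡ P₂adj v u
  s zero zero = Relation.Binary.PropositionalEquality.refl
  s zero (suc zero) = Relation.Binary.PropositionalEquality.refl
  s (suc zero) zero = Relation.Binary.PropositionalEquality.refl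
  s (suc zero) (suc zero) = Relation.Binary.PropositionalEquality.refl
  i : ∀ v → P₂adj v v ≡ false
  i zero = Relation.Binary.PropositionalEquality.refl
  i (suc zero) = Relation.Binary.PropositionalEquality.refl

module Submission where

-- Call a colouring balanced if at every vertex the blue edges outnumber the red ones by exactly
-- one; an alternating colouring is balanced, and balance is all that the forward direction and
-- uniqueness use.  In a balanced colouring leaf edges are blue, so the third edge at a twig base is
-- red, and hence balance survives the removal of a leaf–twig configuration.  Two balanced colourings
-- of a forest agree: the edges where they differ would continue, at every vertex, into a
-- non-backtracking trail that never ends, and in a finite acyclic graph such a trail is impossible.
-- The same argument shows that in a balanced tree without leaf–twig configurations every vertex is a
-- leaf or a twig base; twig bases are then impossible too, so every vertex is a leaf and the tree is
-- P₂.  Conversely, an ASBG-colouring of the reduced form extends across each removal by colouring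
-- vb red and the other new edges blue, and ordering the vertices l₁, ℓ, b, the old ones, l₂.

open import Defs renaming (sym to adj-sym)
open import Data.Nat as ℕ using (ℕ; zero; suc; _+_; _≤_; _<_; z≤n; s≤s; s≤s⁻¹)
open import Data.Nat.Properties
  using (m≢1+n+m; m+1+n≢m; m+1+n≰m; m≤m+n; ≤-antisym; <-cmp; +-comm; +-suc; +-identityʳ; +-monoʳ-<; n<1+n;
         m≤n⇒∃[o]m+o≡n; suc-injective)
open import Data.Bool as Bool using (Bool; true; false; T?; not; if_then_else_)
open import Data.Bool.Properties using (T-≡; not-¬)
open import Data.Fin using (Fin; cast; _≟_; toℕ; fromℕ<; opposite)
open import Data.Fin.Properties
  using (cast-is-id; cast-involutive; toℕ-inject₁; toℕ-fromℕ; toℕ-injective; toℕ<n; toℕ-fromℕ<; pigeonhole;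
         cantor-schröder-bernstein)
  renaming (any? to anyFin?)
import Data.Fin.Permutation as Perm
open import Data.Fin.Permutation using (Permutation′; _⟨$⟩ʳ_; _⟨$⟩ˡ_; inverseʳ)
open import Data.List using (List; []; _∷_; _++_; [_]; length; map; filter; filterᵇ; allFin; tabulate; lookup)
open import Data.List.Properties
  using (length-++; length-map; ++-identityʳ; filter-accept; filter-reject; filter-++; tabulate-cong;
         tabulate-lookup; map-cong; map-cong-local; map-∘)
open import Data.List.Membership.Propositional using (_∈_; _∉_; find; lose)
import Data.List.Membership.DecPropositional as DecMembership
open import Data.List.Membership.Propositional.Properties
  using (∈-filter⁺; ∈-filter⁻; ∈-allFin; ∈-tabulate⁺; ∈-map⁺; ∈-map⁻; ∈-∃++; ∈-++⁻; ∈-++⁺ˡ; ∈-++⁺ʳ; ∈-lookup)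
open import Data.List.Relation.Unary.All as All using (All)
import Data.List.Relation.Unary.All.Properties as All
open import Data.List.Relation.Unary.Any as Any using (here; there; any?)
open import Data.List.Relation.Unary.Any.Properties using (lookup-index)
open import Data.List.Relation.Unary.AllPairs using ([]; _∷_)
open import Data.List.Relation.Unary.Unique.Propositional using (Unique)
open import Data.List.Relation.Unary.Unique.Propositional.Properties
  using (filter⁺; allFin⁺; tabulate⁺) renaming (map⁺ to map⁺ᵘ; ++⁺ to ++⁺ᵘ)
open import Data.List.Relation.Binary.Permutation.Propositional using (_↭_; ↭-refl; ↭-sym; ↭-trans; prep)
open import Data.List.Relation.Binary.Permutation.Propositional.Properties
  using (shift; ↭-length; ∈-resp-↭; filter-↭; map⁺)
open import Data.List.Relation.Binary.Subset.Propositional using (_⊆_)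
open import Data.List.Relation.Binary.Disjoint.Propositional using (Disjoint)
open import Data.Empty using (⊥; ⊥-elim)
open import Data.Product using (Σ-syntax; ∃-syntax; _×_; _,_; proj₁; proj₂)
open import Data.Sum using (_⊎_; inj₁; inj₂)
open import Function using (_∘_)
open import Function.Bundles using (_⇔_; mk⇔; mk↔ₛ′; Equivalence; Injection; Inverse)
open import Function.Properties.Inverse using (↔⇒↣)
open import Function.Definitions using (Injective)
open import Relation.Binary.Construct.Closure.ReflexiveTransitive using (Star; ε; _◅_)
open import Relation.Binary.Definitions using (DecidableEquality; tri<; tri≈; tri>)
open import Relation.Binary.PropositionalEquality
  using (_≡_; _≢_; refl; sym; trans; cong; cong₂; subst; subst₂; module ≡-Reasoning)
open import Relation.Nullary using (¬_; Dec; does; yes; no; ¬?)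
open import Relation.Nullary.Decidable using (dec-true; dec-false; decidable-stable; _×-dec_; _⊎-dec_)
open import Relation.Unary using (Decidable)

module _ {A : Set} where

  ∈-++-skip : ∀ {x y : A} ys₁ {ys₂} → y ∈ ys₁ ++ x ∷ ys₂ → x ≢ y → y ∈ ys₁ ++ ys₂
  ∈-++-skip ys₁ y∈ x≢y with ∈-++⁻ ys₁ y∈
  ... | inj₁ y∈ys₁         = ∈-++⁺ˡ y∈ys₁
  ... | inj₂ (here y≡x)    = ⊥-elim (x≢y (sym y≡x))
  ... | inj₂ (there y∈ys₂) = ∈-++⁺ʳ ys₁ y∈ys₂

  ⊆⇒↭-++ : ∀ {xs ys : List A} → Unique xs → xs ⊆ ys → ∃[ zs ] ys ↭ xs ++ zs
  ⊆⇒↭-++ {[]} {ys} _ _ = ys , ↭-refl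
  ⊆⇒↭-++ {x ∷ xs} (x∉xs ∷ uxs) xs⊆ys with ys₁ , ys₂ , refl ← ∈-∃++ (xs⊆ys (here refl))
    with zs , ys₁₂↭ ← ⊆⇒↭-++ uxs (λ y∈xs → ∈-++-skip ys₁ (xs⊆ys (there y∈xs)) (All.lookup x∉xs y∈xs))
    = zs , ↭-trans (shift x ys₁ ys₂) (prep x ys₁₂↭)

  ⊆-length⇒↭ : ∀ {xs ys : List A} → Unique xs → xs ⊆ ys → length ys ≡ length xs → ys ↭ xs
  ⊆-length⇒↭ {xs} uxs xs⊆ys len with ⊆⇒↭-++ uxs xs⊆ys
  ... | [] , ys↭ = subst (_ ↭_) (++-identityʳ xs) ys↭
  ... | z ∷ zs , ys↭ =
    ⊥-elim (m+1+n≢m (length xs) (trans (sym (length-++ xs)) (trans (sym (↭-length ys↭)) len)))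

  ⊆⇒length≤ : ∀ {xs ys : List A} → Unique xs → xs ⊆ ys → length xs ≤ length ys
  ⊆⇒length≤ {xs} {ys} uxs xs⊆ys with zs , ys↭ ← ⊆⇒↭-++ uxs xs⊆ys =
    subst (length xs ≤_) (trans (sym (length-++ xs)) (sym (↭-length ys↭))) (m≤m+n (length xs) (length zs))

  ⊆-⊇⇒↭ : ∀ {xs ys : List A} → Unique xs → Unique ys → xs ⊆ ys → ys ⊆ xs → ys ↭ xs
  ⊆-⊇⇒↭ uxs uys xs⊆ys ys⊆xs =
    ⊆-length⇒↭ uxs xs⊆ys (≤-antisym (⊆⇒length≤ uys ys⊆xs) (⊆⇒length≤ uxs xs⊆ys))

  ∈-filterᵇ⁺ : ∀ {p : A → Bool} {x xs} → x ∈ xs → p x ≡ true → x ∈ filterᵇ p xs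
  ∈-filterᵇ⁺ {p} x∈xs px = ∈-filter⁺ (T? ∘ p) x∈xs (Equivalence.from T-≡ px)

  ∈-filterᵇ⁻ : ∀ {p : A → Bool} {x} xs → x ∈ filterᵇ p xs → x ∈ xs × p x ≡ true
  ∈-filterᵇ⁻ {p} xs x∈ = let x∈xs , px = ∈-filter⁻ (T? ∘ p) {xs = xs} x∈ in x∈xs , Equivalence.to T-≡ px

  ∉⇒All≢ : ∀ {x : A} {xs} → x ∉ xs → All (x ≢_) xs
  ∉⇒All≢ x∉ = All.tabulate λ y∈ x≡y → x∉ (subst (_∈ _) (sym x≡y) y∈)

  filterᵇ-accept : ∀ (p : A → Bool) {x} xs → p x ≡ true → filterᵇ p (x ∷ xs) ≡ x ∷ filterᵇ p xs
  filterᵇ-accept p _ px = filter-accept (T? ∘ p) (Equivalence.from T-≡ px)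

  filterᵇ-reject : ∀ (p : A → Bool) {x} xs → p x ≢ true → filterᵇ p (x ∷ xs) ≡ filterᵇ p xs
  filterᵇ-reject p _ ¬px = filter-reject (T? ∘ p) (¬px ∘ Equivalence.to T-≡)

  unique-singleton : ∀ {xs : List A} {y} → Unique xs → y ∈ xs → (∀ {x} → x ∈ xs → x ≡ y) → xs ≡ [ y ]
  unique-singleton {x ∷ []} _ _ all≡y = cong [_] (all≡y (here refl))
  unique-singleton {x ∷ z ∷ _} ((x≢z All.∷ _) ∷ _) _ all≡y =
    ⊥-elim (x≢z (trans (all≡y (here refl)) (sym (all≡y (there (here refl))))))

  lookup-injective : ∀ {xs : List A} → Unique xs → Injective _≡_ _≡_ (lookup xs)
  lookup-injective {x ∷ xs} _ {Fin.zero} {Fin.zero} _ = refl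
  lookup-injective {x ∷ xs} (x∉xs ∷ _) {Fin.zero} {Fin.suc j} eq = ⊥-elim (All.lookup x∉xs (∈-lookup j) eq)
  lookup-injective {x ∷ xs} (x∉xs ∷ _) {Fin.suc i} {Fin.zero} eq =
    ⊥-elim (All.lookup x∉xs (∈-lookup i) (sym eq))
  lookup-injective {x ∷ xs} (_ ∷ uxs) {Fin.suc i} {Fin.suc j} eq = cong Fin.suc (lookup-injective uxs eq)

  tabulate-lookup-cast : ∀ {m} (xs : List A) (eq : m ≡ length xs) → tabulate (lookup xs ∘ cast eq) ≡ xs
  tabulate-lookup-cast xs refl = trans (tabulate-cong (cong (lookup xs) ∘ cast-is-id refl)) (tabulate-lookup xs)

filterᵇ-map : ∀ {A B : Set} {p : B → Bool} {q : A → Bool} (f : A → B) → (∀ x → p (f x) ≡ q x) →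
              ∀ xs → filterᵇ p (map f xs) ≡ map f (filterᵇ q xs)
filterᵇ-map f p∘f≡q [] = refl
filterᵇ-map {p = p} {q} f p∘f≡q (x ∷ xs) with q x in qx
... | true  = trans (filterᵇ-accept p (map f xs) (trans (p∘f≡q x) qx))
                (cong (f x ∷_) (filterᵇ-map f p∘f≡q xs))
... | false = trans (filterᵇ-reject p (map f xs) (not-¬ refl ∘ trans (sym (trans (p∘f≡q x) qx))))
                (filterᵇ-map f p∘f≡q xs)

least-witness : ∀ {P : ℕ → Set} → Decidable P → ∀ {n} → P n → ∃[ m ] P m × (∀ {k} → k < m → ¬ P k)
least-witness P? {zero} p = zero , p , λ ()
least-witness {P} P? {suc n} p with P? zero
... | yes p₀ = zero , p₀ , λ ()
... | no ¬p₀ with m , pm , below ← least-witness {P ∘ suc} (P? ∘ suc) p =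
  suc m , pm , λ { {zero} _ → ¬p₀ ; {suc k} k<m → below (s≤s⁻¹ k<m) }

∈-tabulate-permutation : ∀ {n} (π : Permutation′ n) x → x ∈ tabulate (π ⟨$⟩ʳ_)
∈-tabulate-permutation π x = subst (_∈ _) (inverseʳ π) (∈-tabulate⁺ (π ⟨$⟩ˡ x))

unique-tabulate-permutation : ∀ {n} (π : Permutation′ n) → Unique (tabulate (π ⟨$⟩ʳ_))
unique-tabulate-permutation π = tabulate⁺ (Injection.injective (↔⇒↣ π))

enumeration⇒permutation : ∀ {n} (xs : List (Fin n)) → Unique xs → (∀ x → x ∈ xs) →
                          Σ[ π ∈ Permutation′ n ] tabulate (π ⟨$⟩ʳ_) ≡ xs
enumeration⇒permutation {n} xs uxs complete =
  mk↔ₛ′ σ τ σ∘τ τ∘σ , tabulate-lookup-cast xs (sym len)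
  where
  index : Fin n → Fin (length xs)
  index x = Any.index (complete x)

  lookup-index′ : ∀ x → x ≡ lookup xs (index x)
  lookup-index′ x = lookup-index (complete x)

  len : length xs ≡ n
  len = cantor-schröder-bernstein (lookup-injective uxs)
          (λ {x} {y} eq → trans (lookup-index′ x) (trans (cong (lookup xs) eq) (sym (lookup-index′ y))))

  σ : Fin n → Fin n
  σ = lookup xs ∘ cast (sym len)

  τ : Fin n → Fin n
  τ = cast len ∘ index

  σ∘τ : ∀ x → σ (τ x) ≡ x
  σ∘τ x = trans (cong (lookup xs) (cast-involutive (sym len) len (index x))) (sym (lookup-index′ x))

  σ-injective : ∀ {i j} → σ i ≡ σ j → i ≡ j
  σ-injective {i} {j} eq = begin
    i                              ≡⟨ cast-involutive len (sym len) i ⟨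
    cast len (cast (sym len) i)    ≡⟨ cong (cast len) (lookup-injective uxs eq) ⟩
    cast len (cast (sym len) j)    ≡⟨ cast-involutive len (sym len) j ⟩
    j                              ∎
    where open ≡-Reasoning

  τ∘σ : ∀ i → τ (σ i) ≡ i
  τ∘σ i = σ-injective (σ∘τ (σ i))

Edge-sym : ∀ G {u v} → Edge G u v → Edge G v u
Edge-sym G {u} {v} e = trans (adj-sym G v u) e

Edge-irrefl : ∀ G {u v} → Edge G u v → u ≢ v
Edge-irrefl G {u} e refl with () ← trans (sym e) (irr G u)

Edge? : ∀ G u v → Dec (Edge G u v)
Edge? G u v = adj G u v Bool.≟ true

module _ (G : Graph) {u : Fin (n G)} where

  unique-neighbours : Unique (neighbours G u)
  unique-neighbours = filter⁺ _ (allFin⁺ (n G))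

  ∈-neighbours⁺ : ∀ {x} → Edge G u x → x ∈ neighbours G u
  ∈-neighbours⁺ {x} = ∈-filterᵇ⁺ (∈-allFin x)

  ∈-neighbours⁻ : ∀ {x} → x ∈ neighbours G u → Edge G u x
  ∈-neighbours⁻ = proj₂ ∘ ∈-filterᵇ⁻ (allFin (n G))

  neighbours-↭-deg : ∀ {xs} → Unique xs → (∀ {x} → x ∈ xs → Edge G u x) → deg G u ≡ length xs →
                     neighbours G u ↭ xs
  neighbours-↭-deg uxs edges = ⊆-length⇒↭ uxs (∈-neighbours⁺ ∘ edges)

  neighbours-↭ : ∀ {xs} → Unique xs → (∀ {x} → x ∈ xs → Edge G u x) → (∀ {x} → Edge G u x → x ∈ xs) →
                 neighbours G u ↭ xs
  neighbours-↭ uxs sound complete =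
    ⊆-⊇⇒↭ uxs unique-neighbours (∈-neighbours⁺ ∘ sound) (complete ∘ ∈-neighbours⁻)

  ∈-↭-neighbours : ∀ {xs x} → neighbours G u ↭ xs → Edge G u x → x ∈ xs
  ∈-↭-neighbours p e = ∈-resp-↭ p (∈-neighbours⁺ e)

neighbours-split : ∀ G {u w} → Edge G u w →
                   ∃[ rest ] Unique rest × neighbours G u ↭ w ∷ rest × (∀ {x} → x ∈ rest → Edge G u x × x ≢ w)
neighbours-split G {u} {w} uw = rest , unique-rest , neighbours-↭ G (w∉rest ∷ unique-rest) sound complete ,
  λ x∈ → let x∈nbrs , x≢w = ∈-rest⁻ x∈ in ∈-neighbours⁻ G x∈nbrs , x≢w
  where
  rest = filter (λ x → ¬? (x ≟ w)) (neighbours G u)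

  ∈-rest⁻ : ∀ {x} → x ∈ rest → x ∈ neighbours G u × x ≢ w
  ∈-rest⁻ = ∈-filter⁻ (λ x → ¬? (x ≟ w)) {xs = neighbours G u}

  unique-rest : Unique rest
  unique-rest = filter⁺ _ (unique-neighbours G)

  w∉rest : All (w ≢_) rest
  w∉rest = All.tabulate λ x∈ w≡x → proj₂ (∈-rest⁻ x∈) (sym w≡x)

  sound : ∀ {x} → x ∈ w ∷ rest → Edge G u x
  sound (here refl) = uw
  sound (there x∈)  = ∈-neighbours⁻ G (proj₁ (∈-rest⁻ x∈))

  complete : ∀ {x} → Edge G u x → x ∈ w ∷ rest
  complete {x} ux with x ≟ w
  ... | yes refl = here refl
  ... | no x≢w   = there (∈-filter⁺ (λ x → ¬? (x ≟ w)) (∈-neighbours⁺ G ux) x≢w)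

IsLeaf? : ∀ G v → Dec (IsLeaf G v)
IsLeaf? G v = deg G v ℕ.≟ 1

leaf-neighbours : ∀ G {ℓ a} → IsLeaf G ℓ → Edge G ℓ a → neighbours G ℓ ↭ [ a ]
leaf-neighbours G lf e = neighbours-↭-deg G (All.[] ∷ []) (λ { (here refl) → e }) lf

leaf-neighbour-unique : ∀ G {ℓ a x} → IsLeaf G ℓ → Edge G ℓ a → Edge G ℓ x → x ≡ a
leaf-neighbour-unique G lf e e′ with here x≡a ← ∈-↭-neighbours G (leaf-neighbours G lf e) e′ = x≡a

leaf⇒neighbour : ∀ G {u} → IsLeaf G u → ∃[ x ] Edge G u x
leaf⇒neighbour G {u} u-leaf with neighbours G u | ∈-neighbours⁻ G {u}
... | x ∷ _ | ∈⇒Edge = x , ∈⇒Edge (here refl)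

module _ (G : Graph) (π : Permutation′ (n G)) {u : Fin (n G)} where

  unique-neighboursIn : Unique (neighboursIn G π u)
  unique-neighboursIn = filter⁺ _ (unique-tabulate-permutation π)

  ∈-neighboursIn⁺ : ∀ {x} → Edge G u x → x ∈ neighboursIn G π u
  ∈-neighboursIn⁺ {x} = ∈-filterᵇ⁺ (∈-tabulate-permutation π x)

  ∈-neighboursIn⁻ : ∀ {x} → x ∈ neighboursIn G π u → Edge G u x
  ∈-neighboursIn⁻ = proj₂ ∘ ∈-filterᵇ⁻ (tabulate (π ⟨$⟩ʳ_))

  neighbours↭neighboursIn : neighbours G u ↭ neighboursIn G π u
  neighbours↭neighboursIn = neighbours-↭ G unique-neighboursIn ∈-neighboursIn⁻ ∈-neighboursIn⁺

  neighboursIn-leaf : ∀ {a} → IsLeaf G u → Edge G u a → neighboursIn G π u ≡ [ a ]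
  neighboursIn-leaf u-leaf ua = unique-singleton unique-neighboursIn (∈-neighboursIn⁺ ua)
    (λ x∈ → leaf-neighbour-unique G u-leaf ua (∈-neighboursIn⁻ x∈))

record TwigBase (G : Graph) (b : Fin (n G)) : Set where
  field
    deg≡3       : deg G b ≡ 3
    leaf₁ leaf₂ : Fin (n G)
    leaf₁≢leaf₂ : leaf₁ ≢ leaf₂
    isLeaf₁     : IsLeaf G leaf₁
    isLeaf₂     : IsLeaf G leaf₂
    edge₁       : Edge G b leaf₁
    edge₂       : Edge G b leaf₂

module _ {G : Graph} {b : Fin (n G)} (t : TwigBase G b) where
  open TwigBase t
  open DecMembership (_≟_ {n G}) using (_∈?_)

  twigBase-neighbours : ∀ {u} → Edge G b u → u ≢ leaf₁ → u ≢ leaf₂ → neighbours G b ↭ leaf₁ ∷ leaf₂ ∷ u ∷ []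
  twigBase-neighbours {u} e u≢₁ u≢₂ =
    neighbours-↭-deg G ((leaf₁≢leaf₂ All.∷ (u≢₁ ∘ sym) All.∷ All.[]) ∷ ((u≢₂ ∘ sym) All.∷ All.[]) ∷ All.[] ∷ [])
      (λ { (here refl) → edge₁ ; (there (here refl)) → edge₂ ; (there (there (here refl))) → e }) deg≡3

  twigBase-third-neighbour : ∃[ u ] Edge G b u × u ≢ leaf₁ × u ≢ leaf₂
  twigBase-third-neighbour with any? (λ x → ¬? (x ∈? leaf₁ ∷ leaf₂ ∷ [])) (neighbours G b)
  ... | yes some with x , x∈ , x∉ ← find some = x , ∈-neighbours⁻ G x∈ , x∉ ∘ here , x∉ ∘ there ∘ here
  ... | no none = ⊥-elim (m+1+n≰m 2 (subst (_≤ 2) deg≡3 (⊆⇒length≤ (unique-neighbours G) nbrs⊆leaves)))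
    where
    nbrs⊆leaves : neighbours G b ⊆ leaf₁ ∷ leaf₂ ∷ []
    nbrs⊆leaves {x} x∈ = decidable-stable (x ∈? leaf₁ ∷ leaf₂ ∷ []) (λ x∉ → none (lose x∈ x∉))

TwigBase? : ∀ G b → Dec (TwigBase G b)
TwigBase? G b with deg G b ℕ.≟ 3
... | no deg≢3 = no (deg≢3 ∘ TwigBase.deg≡3)
... | yes deg≡3 with anyFin? (λ l₁ → anyFin? (λ l₂ →
                      ¬? (l₁ ≟ l₂) ×-dec IsLeaf? G l₁ ×-dec IsLeaf? G l₂ ×-dec Edge? G b l₁ ×-dec Edge? G b l₂))
...   | yes (l₁ , l₂ , l₁≢l₂ , lf₁ , lf₂ , e₁ , e₂) = yes record
        { deg≡3 = deg≡3 ; leaf₁ = l₁ ; leaf₂ = l₂ ; leaf₁≢leaf₂ = l₁≢l₂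
        ; isLeaf₁ = lf₁ ; isLeaf₂ = lf₂ ; edge₁ = e₁ ; edge₂ = e₂ }
...   | no none = no λ t → let open TwigBase t in
        none (leaf₁ , leaf₂ , leaf₁≢leaf₂ , isLeaf₁ , isLeaf₂ , edge₁ , edge₂)

twigBase-from-two-leaves : ∀ G {u} → deg G u ≡ 3 → ∀ xs → length xs ≡ 2 → Unique xs →
                           (∀ {x} → x ∈ xs → Edge G u x × IsLeaf G x) → TwigBase G u
twigBase-from-two-leaves G deg≡3 (x₁ ∷ x₂ ∷ []) _ ((x₁≢x₂ All.∷ All.[]) ∷ _) leaves = record
  { deg≡3 = deg≡3 ; leaf₁ = x₁ ; leaf₂ = x₂ ; leaf₁≢leaf₂ = x₁≢x₂
  ; isLeaf₁ = proj₂ (leaves (here refl)) ; isLeaf₂ = proj₂ (leaves (there (here refl)))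
  ; edge₁ = proj₁ (leaves (here refl)) ; edge₂ = proj₁ (leaves (there (here refl))) }

leafTwig : ∀ G {v ℓ b} → ¬ IsLeaf G v → IsLeaf G ℓ → Edge G ℓ v → TwigBase G b → Edge G b v → LeafTwig G v
leafTwig G {v} {ℓ} {b} v-nonleaf ℓ-leaf ℓv t bv = record
  { ℓ = ℓ ; b = b ; l₁ = leaf₁ ; l₂ = leaf₂
  ; ℓ≢v = Edge-irrefl G ℓv
  ; b≢v = Edge-irrefl G bv
  ; l₁≢v = λ { refl → v-nonleaf isLeaf₁ }
  ; l₂≢v = λ { refl → v-nonleaf isLeaf₂ }
  ; ℓ≢b = leaf≢base ℓ-leaf
  ; ℓ≢l₁ = λ { refl → Edge-irrefl G bv (leaf-neighbour-unique G ℓ-leaf ℓv (Edge-sym G edge₁)) }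
  ; ℓ≢l₂ = λ { refl → Edge-irrefl G bv (leaf-neighbour-unique G ℓ-leaf ℓv (Edge-sym G edge₂)) }
  ; b≢l₁ = leaf≢base isLeaf₁ ∘ sym
  ; b≢l₂ = leaf≢base isLeaf₂ ∘ sym
  ; l₁≢l₂ = leaf₁≢leaf₂
  ; ℓ-leaf = ℓ-leaf ; ℓv = ℓv ; bv = bv ; b-deg3 = deg≡3
  ; l₁-leaf = isLeaf₁ ; l₂-leaf = isLeaf₂ ; bl₁ = edge₁ ; bl₂ = edge₂ }
  where
  open TwigBase t
  leaf≢base : ∀ {x} → IsLeaf G x → x ≢ b
  leaf≢base x-leaf refl with () ← trans (sym x-leaf) deg≡3

-- Balanced colourings

_≟ᶜ_ : DecidableEquality Colour
blue ≟ᶜ blue = yes refl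
blue ≟ᶜ red  = no λ ()
red  ≟ᶜ blue = no λ ()
red  ≟ᶜ red  = yes refl

count : Colour → List Colour → ℕ
count k = length ∘ filter (_≟ᶜ k)

count-All≡ : ∀ {k ks} → All (_≡ k) ks → count k ks ≡ length ks
count-All≡ All.[] = refl
count-All≡ {k} (refl All.∷ ks≡k) with k ≟ᶜ k
... | yes _  = cong suc (count-All≡ ks≡k)
... | no k≢k = ⊥-elim (k≢k refl)

count-All≢ : ∀ {k k′ ks} → All (_≡ k′) ks → k′ ≢ k → count k ks ≡ 0
count-All≢ All.[] _ = refl
count-All≢ {k} {k′} (refl All.∷ ks≡k′) k′≢k with k′ ≟ᶜ k
... | yes k′≡k = ⊥-elim (k′≢k k′≡k)
... | no _     = count-All≢ ks≡k′ k′≢k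

OneMoreBlue : List Colour → Set
OneMoreBlue ks = count blue ks ≡ suc (count red ks)

OneMoreBlue-resp-↭ : ∀ {ks ks′} → ks ↭ ks′ → OneMoreBlue ks → OneMoreBlue ks′
OneMoreBlue-resp-↭ {ks} {ks′} p h = trans (sym (count-↭ blue)) (trans h (cong suc (count-↭ red)))
  where
  count-↭ : ∀ k → count k ks ≡ count k ks′
  count-↭ k = ↭-length (filter-↭ (_≟ᶜ k) p)

AltBlue⇒OneMoreBlue : ∀ {ks} → AltBlue ks → OneMoreBlue ks
AltBlue⇒OneMoreBlue single   = refl
AltBlue⇒OneMoreBlue (more a) = cong suc (AltBlue⇒OneMoreBlue a)

OneMoreBlue-[k]⇒blue : ∀ {k} → OneMoreBlue (k ∷ []) → k ≡ blue
OneMoreBlue-[k]⇒blue {blue} _ = refl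

OneMoreBlue-[blue,blue,k]⇒red : ∀ {k} → OneMoreBlue (blue ∷ blue ∷ k ∷ []) → k ≡ red
OneMoreBlue-[blue,blue,k]⇒red {red} _ = refl

OneMoreBlue-head-unique : ∀ {k k′ ks} → OneMoreBlue (k ∷ ks) → OneMoreBlue (k′ ∷ ks) → k ≡ k′
OneMoreBlue-head-unique {blue} {blue} _ _ = refl
OneMoreBlue-head-unique {red}  {red}  _ _ = refl
OneMoreBlue-head-unique {blue} {red}  h h′ = ⊥-elim (m≢1+n+m _ (trans (sym (suc-injective h)) h′))
OneMoreBlue-head-unique {red}  {blue} h h′ = ⊥-elim (m≢1+n+m _ (trans (sym (suc-injective h′)) h))

OneMoreBlue-∷-reds⇒length≡0 : ∀ {k ks} → OneMoreBlue (k ∷ ks) → All (_≡ red) ks → length ks ≡ 0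
OneMoreBlue-∷-reds⇒length≡0 {blue} {ks} h reds =
  sym (suc-injective (trans (sym (cong suc (count-All≢ reds λ ()))) (trans h (cong suc (count-All≡ reds)))))
OneMoreBlue-∷-reds⇒length≡0 {red} h reds with () ← trans (sym (count-All≢ reds λ ())) h

OneMoreBlue-∷-blues⇒length≡0⊎2 : ∀ {k ks} → OneMoreBlue (k ∷ ks) → All (_≡ blue) ks →
                                 length ks ≡ 0 ⊎ length ks ≡ 2
OneMoreBlue-∷-blues⇒length≡0⊎2 {blue} h blues =
  inj₁ (suc-injective (trans (sym (cong suc (count-All≡ blues))) (trans h (cong suc (count-All≢ blues λ ())))))
OneMoreBlue-∷-blues⇒length≡0⊎2 {red} h blues =
  inj₂ (trans (sym (count-All≡ blues)) (trans h (cong suc (cong suc (count-All≢ blues λ ())))))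

record Balanced (G : Graph) (c : Colouring G) : Set where
  constructor balanced
  field around : ∀ u → OneMoreBlue (map (col c u) (neighbours G u))

alternating⇒balanced : ∀ G c (π : Permutation′ (n G)) → (∀ u → AltBlue (map (col c u) (neighboursIn G π u))) →
                       Balanced G c
alternating⇒balanced G c π alt = balanced λ u →
  OneMoreBlue-resp-↭ (map⁺ _ (↭-sym (neighbours↭neighboursIn G π))) (AltBlue⇒OneMoreBlue (alt u))

ASBG⇒Balanced : ∀ G c → IsASBGColouring G c → Balanced G c
ASBG⇒Balanced G c (_ , _ , π , alt) = alternating⇒balanced G c π alt

module _ {G : Graph} {c : Colouring G} (bal : Balanced G c) where

  balanced-at : ∀ {u xs} → neighbours G u ↭ xs → OneMoreBlue (map (col c u) xs)
  balanced-at {u} p = OneMoreBlue-resp-↭ (map⁺ _ p) (Balanced.around bal u)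

  leaf-edge-blue : ∀ {ℓ a} → IsLeaf G ℓ → Edge G ℓ a → col c ℓ a ≡ blue
  leaf-edge-blue ℓ-leaf e = OneMoreBlue-[k]⇒blue (balanced-at (leaf-neighbours G ℓ-leaf e))

  edge-to-leaf-blue : ∀ {a ℓ} → Edge G a ℓ → IsLeaf G ℓ → col c a ℓ ≡ blue
  edge-to-leaf-blue e ℓ-leaf = trans (csym c _ _ e) (leaf-edge-blue ℓ-leaf (Edge-sym G e))

  twigBase-edge-red : ∀ {b u} (t : TwigBase G b) → Edge G b u →
                      u ≢ TwigBase.leaf₁ t → u ≢ TwigBase.leaf₂ t → col c b u ≡ red
  twigBase-edge-red {b} {u} t e u≢₁ u≢₂ = OneMoreBlue-[blue,blue,k]⇒red
    (subst₂ (λ k k′ → OneMoreBlue (k ∷ k′ ∷ col c b u ∷ []))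
      (edge-to-leaf-blue edge₁ isLeaf₁) (edge-to-leaf-blue edge₂ isLeaf₂)
      (balanced-at (twigBase-neighbours t e u≢₁ u≢₂)))
    where open TwigBase t

balanced⇒neighbour : ∀ {G c} → Balanced G c → ∀ u → ∃[ x ] Edge G u x
balanced⇒neighbour {G} {c} bal u with neighbours G u | Balanced.around bal u | ∈-neighbours⁻ G {u}
... | x ∷ _ | _ | ∈⇒Edge = x , ∈⇒Edge (here refl)

-- Trails in acyclic graphs

module _ (G : Graph) (q : ℕ → Fin (n G)) (steps : ∀ k → Edge G (q k) (q (suc k))) where

  closedTrail⇒cycle : ∀ m → q (3 + m) ≡ q 0 → (∀ {a b} → a < b → b < 3 + m → q a ≢ q b) → Cycle G
  closedTrail⇒cycle m closed distinct = record
    { m = m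
    ; c = q ∘ toℕ
    ; inj = injective
    ; consec = λ k → subst (λ i → Edge G (q i) (q (suc (toℕ k)))) (sym (toℕ-inject₁ k)) (steps (toℕ k))
    ; close = subst₂ (Edge G) (cong q (sym (toℕ-fromℕ (2 + m)))) closed (steps (2 + m))
    }
    where
    injective : ∀ {a b : Fin (3 + m)} → q (toℕ a) ≡ q (toℕ b) → a ≡ b
    injective {a} {b} eq with <-cmp (toℕ a) (toℕ b)
    ... | tri< a<b _ _ = ⊥-elim (distinct a<b (toℕ<n b) eq)
    ... | tri≈ _ a≡b _ = toℕ-injective a≡b
    ... | tri> _ _ b<a = ⊥-elim (distinct b<a (toℕ<n a) (sym eq))

module _ (G : Graph) (acyclic : Acyclic G) (p : ℕ → Fin (n G))
         (steps : ∀ k → Edge G (p k) (p (suc k)))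
         (nonBacktracking : ∀ k → p (suc (suc k)) ≢ p k) where

  private
    Repeat : ℕ → Set
    Repeat j = Σ[ i ∈ Fin j ] p (toℕ i) ≡ p j

    repeat? : Decidable Repeat
    repeat? j = anyFin? (λ i → p (toℕ i) ≟ p j)

    first-repeat⇒⊥ : ∀ i d → p i ≡ p (suc i + d) →
                     (∀ {a b} → a < b → b < suc i + d → p a ≢ p b) → ⊥
    first-repeat⇒⊥ i zero eq _ = Edge-irrefl G (steps i) (trans eq (cong (p ∘ suc) (+-identityʳ i)))
    first-repeat⇒⊥ i (suc zero) eq _ = nonBacktracking i (sym (trans eq (cong (p ∘ suc) (+-comm i 1))))
    first-repeat⇒⊥ i (suc (suc m)) eq distinct = acyclic (closedTrail⇒cycle G (p ∘ (i +_)) steps′ m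
      (trans (cong p (+-suc i (2 + m))) (trans (sym eq) (cong p (sym (+-identityʳ i)))))
      (λ {_} {b} a<b b<3+m → distinct (+-monoʳ-< i a<b) (subst (i + b <_) (+-suc i (2 + m)) (+-monoʳ-< i b<3+m))))
      where
      steps′ : ∀ k → Edge G (p (i + k)) (p (i + suc k))
      steps′ k = subst (Edge G (p (i + k)) ∘ p) (sym (+-suc i k)) (steps (i + k))

  -- The first repetition closes a trail of distinct vertices; irreflexivity and non-backtracking
  -- rule out lengths 1 and 2, so it is a cycle.
  acyclic⇒¬endlessTrail : ⊥
  acyclic⇒¬endlessTrail
    with i , j , i<j , eq ← pigeonhole (n<1+n (n G)) (p ∘ toℕ)
    with j₀ , (i₀ , rep) , minimal ← least-witness repeat? (fromℕ< i<j , trans (cong p (toℕ-fromℕ< i<j)) eq)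
    with d , j₀≡ ← m≤n⇒∃[o]m+o≡n (toℕ<n i₀)
    = first-repeat⇒⊥ (toℕ i₀) d (trans rep (cong p (sym j₀≡))) (λ a<b → distinct a<b ∘ subst (_ <_) j₀≡)
    where
    distinct : ∀ {a b} → a < b → b < j₀ → p a ≢ p b
    distinct a<b b<j₀ eq = minimal b<j₀ (fromℕ< a<b , trans (cong p (toℕ-fromℕ< a<b)) eq)

module _ (G : Graph) (acyclic : Acyclic G) (R : Fin (n G) → Fin (n G) → Set)
         (R⇒Edge : ∀ {u w} → R u w → Edge G u w)
         (continue : ∀ {w u} → R w u → ∃[ x ] x ≢ w × R u x) where

  acyclic⇒¬extendableTrail : ∀ {u w} → ¬ R u w
  acyclic⇒¬extendableTrail {u} {w} r =
    acyclic⇒¬endlessTrail G acyclic (proj₁ ∘ state) (λ k → R⇒Edge (proj₂ (proj₂ (state k))))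
      (λ k → proj₁ (proj₂ (continue (proj₂ (proj₂ (state k))))))
    where
    State = Σ[ a ∈ Fin (n G) ] Σ[ b ∈ Fin (n G) ] R a b

    state : ℕ → State
    state zero    = u , w , r
    state (suc k) = let _ , b , r = state k ; x , _ , r′ = continue r in b , x , r′

-- Uniqueness

balanced-determined : ∀ G (c c′ : Colouring G) → Balanced G c → Balanced G c′ → ∀ {u w} → Edge G u w →
                      (∀ {x} → Edge G u x → x ≢ w → col c u x ≡ col c′ u x) → col c u w ≡ col c′ u w
balanced-determined G c c′ bal bal′ {u} {w} uw agree
  with rest , _ , nbrs↭ , rest-edges ← neighbours-split G uw =
  OneMoreBlue-head-unique (balanced-at bal nbrs↭)
    (subst (OneMoreBlue ∘ (col c′ u w ∷_)) (sym (map-cong-local (All.tabulate agree-rest)))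
      (balanced-at bal′ nbrs↭))
  where
  agree-rest : ∀ {x} → x ∈ rest → col c u x ≡ col c′ u x
  agree-rest x∈ = let ux , x≢w = rest-edges x∈ in agree ux x≢w

balanced-colourings-agree : ∀ G → Acyclic G → (c c′ : Colouring G) → Balanced G c → Balanced G c′ →
                            ∀ u v → Edge G u v → col c u v ≡ col c′ u v
balanced-colourings-agree G acyclic c c′ bal bal′ u v uv with col c u v ≟ᶜ col c′ u v
... | yes agree  = agree
... | no ¬agree = ⊥-elim (acyclic⇒¬extendableTrail G acyclic Disagree proj₁ continue (uv , ¬agree))
  where
  Disagree : Fin (n G) → Fin (n G) → Set
  Disagree a b = Edge G a b × col c a b ≢ col c′ a b

  continue : ∀ {w u} → Disagree w u → ∃[ x ] x ≢ w × Disagree u x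
  continue {w} {u} (wu , ¬agree) with anyFin? (λ x → ¬? (x ≟ w) ×-dec Edge? G u x ×-dec ¬? (col c u x ≟ᶜ col c′ u x))
  ... | yes (x , x≢w , d) = x , x≢w , d
  ... | no none = ⊥-elim (¬agree (trans (csym c w u wu)
                    (trans (balanced-determined G c c′ bal bal′ (Edge-sym G wu) agree′) (sym (csym c′ w u wu)))))
    where
    agree′ : ∀ {x} → Edge G u x → x ≢ w → col c u x ≡ col c′ u x
    agree′ {x} ux x≢w = decidable-stable (col c u x ≟ᶜ col c′ u x) λ d → none (x , x≢w , ux , d)

module _ {G : Graph} {c : Colouring G} (bal : Balanced G c) where

  module _ {u w rest} (nbrs↭ : neighbours G u ↭ w ∷ rest) (rest-edges : ∀ {x} → x ∈ rest → Edge G u x) where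

    other-edges-red⇒leaf : (∀ {x} → x ∈ rest → col c u x ≡ red) → IsLeaf G u
    other-edges-red⇒leaf reds = trans (↭-length nbrs↭) (cong suc (trans (sym (length-map (col c u) rest))
      (OneMoreBlue-∷-reds⇒length≡0 {col c u w} (balanced-at bal nbrs↭) (All.map⁺ (All.tabulate reds)))))

    other-neighbours-leaves⇒leaf⊎twigBase : Unique rest → (∀ {x} → x ∈ rest → IsLeaf G x) →
                                            IsLeaf G u ⊎ TwigBase G u
    other-neighbours-leaves⇒leaf⊎twigBase unique-rest leaves
      with OneMoreBlue-∷-blues⇒length≡0⊎2 {col c u w} (balanced-at bal nbrs↭)
             (All.map⁺ (All.tabulate λ x∈ → edge-to-leaf-blue bal (rest-edges x∈) (leaves x∈)))
    ... | inj₁ length≡0 =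
      inj₁ (trans (↭-length nbrs↭) (cong suc (trans (sym (length-map (col c u) rest)) length≡0)))
    ... | inj₂ length≡2 = inj₂ (twigBase-from-two-leaves G (trans (↭-length nbrs↭) (cong suc rest-length))
                                  rest rest-length unique-rest λ x∈ → rest-edges x∈ , leaves x∈)
      where
      rest-length : length rest ≡ 2
      rest-length = trans (sym (length-map (col c u) rest)) length≡2

  module _ (noLeafTwig : HasNoLeafTwig G) where

    Inner : Fin (n G) → Set
    Inner u = ¬ IsLeaf G u × ¬ TwigBase G u

    Inner? : Decidable Inner
    Inner? u = ¬? (IsLeaf? G u) ×-dec ¬? (TwigBase? G u)

    -- Were all other neighbours of u leaves or twig bases, they would either form a leaf–twig
    -- configuration at u or, by balance, make u itself a leaf or a twig base.
    inner-continues : ∀ {u w} → Inner u → Edge G u w → ∃[ x ] x ≢ w × Edge G u x × Inner x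
    inner-continues {u} {w} (u-nonleaf , u-nonbase) uw
      with rest , unique-rest , nbrs↭ , rest-edges ← neighbours-split G uw
      with any? Inner? rest
    ... | yes some = let x , x∈ , x-inner = find some ; ux , x≢w = rest-edges x∈ in x , x≢w , ux , x-inner
    ... | no none with any? (IsLeaf? G) rest | any? (TwigBase? G) rest
    ...   | yes some-leaf | yes some-base
            with ℓ , ℓ∈ , ℓ-leaf ← find some-leaf | b , b∈ , t ← find some-base =
      ⊥-elim (noLeafTwig u (leafTwig G u-nonleaf ℓ-leaf (Edge-sym G (edge ℓ∈)) t (Edge-sym G (edge b∈))))
      where
      edge : ∀ {x} → x ∈ rest → Edge G u x
      edge = proj₁ ∘ rest-edges
    ...   | no no-leaf | _ = ⊥-elim (u-nonleaf (other-edges-red⇒leaf nbrs↭ (proj₁ ∘ rest-edges) edge-red))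
      where
      edge-red : ∀ {x} → x ∈ rest → col c u x ≡ red
      edge-red {x} x∈ =
        trans (csym c u x ux) (twigBase-edge-red bal t (Edge-sym G ux) (u≢leaf isLeaf₁) (u≢leaf isLeaf₂))
        where
        ux = proj₁ (rest-edges x∈)
        t : TwigBase G x
        t = decidable-stable (TwigBase? G x) λ ¬t → none (lose x∈ ((no-leaf ∘ lose x∈) , ¬t))
        open TwigBase t
        u≢leaf : ∀ {l} → IsLeaf G l → u ≢ l
        u≢leaf l-leaf refl = u-nonleaf l-leaf
    ...   | yes _ | no no-base
            with other-neighbours-leaves⇒leaf⊎twigBase nbrs↭ (proj₁ ∘ rest-edges) unique-rest leaf
      where
      leaf : ∀ {x} → x ∈ rest → IsLeaf G x
      leaf {x} x∈ = decidable-stable (IsLeaf? G x) λ ¬leaf → none (lose x∈ (¬leaf , no-base ∘ lose x∈))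
    ... | inj₁ u-leaf = ⊥-elim (u-nonleaf u-leaf)
    ... | inj₂ u-base = ⊥-elim (u-nonbase u-base)

    module _ (acyclic : Acyclic G) where

      no-inner : ∀ u → ¬ Inner u
      no-inner u u-inner
        with w , uw ← balanced⇒neighbour bal u
        with x , _ , ux , x-inner ← inner-continues u-inner uw =
        acyclic⇒¬extendableTrail G acyclic InnerEdge proj₁ continue (ux , u-inner , x-inner)
        where
        InnerEdge : Fin (n G) → Fin (n G) → Set
        InnerEdge a b = Edge G a b × Inner a × Inner b

        continue : ∀ {a b} → InnerEdge a b → ∃[ x ] x ≢ a × InnerEdge b x
        continue (ab , _ , b-inner) with x , x≢a , bx , x-inner ← inner-continues b-inner (Edge-sym G ab) =
          x , x≢a , bx , b-inner , x-inner

      no-twigBase : ∀ b → ¬ TwigBase G b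
      no-twigBase b t with x , bx , x≢₁ , x≢₂ ← twigBase-third-neighbour t with IsLeaf? G x | TwigBase? G x
      ... | yes x-leaf | _
            with () ← trans (sym (edge-to-leaf-blue bal bx x-leaf)) (twigBase-edge-red bal t bx x≢₁ x≢₂)
      ... | no x-nonleaf | yes x-base =
        noLeafTwig b (leafTwig G b-nonleaf isLeaf₁ (Edge-sym G edge₁) x-base (Edge-sym G bx))
        where
        open TwigBase t
        b-nonleaf : ¬ IsLeaf G b
        b-nonleaf b-leaf with () ← trans (sym b-leaf) deg≡3
      ... | no x-nonleaf | no x-nonbase = no-inner x (x-nonleaf , x-nonbase)

      all-leaves : ∀ u → IsLeaf G u
      all-leaves u = decidable-stable (IsLeaf? G u) λ u-nonleaf → no-inner u (u-nonleaf , no-twigBase u)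

module _ (G : Graph) (connected : Connected G) (leaves : ∀ u → IsLeaf G u) (a : Fin (n G)) where

  private
    a′ = proj₁ (leaf⇒neighbour G (leaves a))
    aa′ = proj₂ (leaf⇒neighbour G (leaves a))

    stays : ∀ {x z} → x ≡ a ⊎ x ≡ a′ → Walk G x z → z ≡ a ⊎ z ≡ a′
    stays x∈ here = x∈
    stays (inj₁ refl) (step xy walk) = stays (inj₂ (leaf-neighbour-unique G (leaves a) aa′ xy)) walk
    stays (inj₂ refl) (step xy walk) =
      stays (inj₁ (leaf-neighbour-unique G (leaves a′) (Edge-sym G aa′) xy)) walk

    a-or-a′ : ∀ z → z ≡ a ⊎ z ≡ a′
    a-or-a′ z = stays (inj₁ refl) (connected a z)

    to : Fin (n G) → Fin 2
    to z = if does (z ≟ a) then Fin.zero else Fin.suc Fin.zero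

    from : Fin 2 → Fin (n G)
    from Fin.zero = a
    from (Fin.suc Fin.zero) = a′

    to-a : to a ≡ Fin.zero
    to-a = cong (λ d → if d then _ else _) (dec-true (a ≟ a) refl)

    to-a′ : to a′ ≡ Fin.suc Fin.zero
    to-a′ = cong (λ d → if d then _ else _) (dec-false (a′ ≟ a) (Edge-irrefl G aa′ ∘ sym))

    to∘from : ∀ i → to (from i) ≡ i
    to∘from Fin.zero = to-a
    to∘from (Fin.suc Fin.zero) = to-a′

    from∘to : ∀ z → from (to z) ≡ z
    from∘to z with a-or-a′ z
    ... | inj₁ refl = cong from to-a
    ... | inj₂ refl = cong from to-a′

    adj-to : ∀ u v → adj G u v ≡ P₂adj (to u) (to v)
    adj-to u v with a-or-a′ u | a-or-a′ v
    ... | inj₁ refl | inj₁ refl rewrite to-a = irr G a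
    ... | inj₁ refl | inj₂ refl rewrite to-a | to-a′ = aa′
    ... | inj₂ refl | inj₁ refl rewrite to-a | to-a′ = Edge-sym G aa′
    ... | inj₂ refl | inj₂ refl rewrite to-a′ = irr G a′

  all-leaves⇒≅P₂ : G ≅ P₂
  all-leaves⇒≅P₂ = record { f = mk↔ₛ′ to from to∘from from∘to ; f-adj = adj-to }

-- Removing a leaf–twig configuration

module Removal {G : Graph} {v : Fin (n G)} {C : LeafTwig G v} {H : Graph} (R : RemovalOf G C H) where
  open LeafTwig C
  open RemovalOf R

  inConfig? : ∀ w → Dec (InConfig C w)
  inConfig? w = (w ≟ ℓ) ⊎-dec ((w ≟ b) ⊎-dec ((w ≟ l₁) ⊎-dec (w ≟ l₂)))

  ℓ∈C : InConfig C ℓ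
  ℓ∈C = inj₁ refl

  b∈C : InConfig C b
  b∈C = inj₂ (inj₁ refl)

  l₁∈C : InConfig C l₁
  l₁∈C = inj₂ (inj₂ (inj₁ refl))

  l₂∈C : InConfig C l₂
  l₂∈C = inj₂ (inj₂ (inj₂ refl))

  v∉C : ¬ InConfig C v
  v∉C (inj₁ refl)               = ℓ≢v refl
  v∉C (inj₂ (inj₁ refl))        = b≢v refl
  v∉C (inj₂ (inj₂ (inj₁ refl))) = l₁≢v refl
  v∉C (inj₂ (inj₂ (inj₂ refl))) = l₂≢v refl

  twigBase : TwigBase G b
  twigBase = record { deg≡3 = b-deg3 ; leaf₁ = l₁ ; leaf₂ = l₂ ; leaf₁≢leaf₂ = l₁≢l₂
                    ; isLeaf₁ = l₁-leaf ; isLeaf₂ = l₂-leaf ; edge₁ = bl₁ ; edge₂ = bl₂ }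

  b-neighbour : ∀ {x} → Edge G b x → x ≡ l₁ ⊎ x ≡ l₂ ⊎ x ≡ v
  b-neighbour bx with ∈-↭-neighbours G (twigBase-neighbours twigBase bv (l₁≢v ∘ sym) (l₂≢v ∘ sym)) bx
  ... | here x≡l₁                = inj₁ x≡l₁
  ... | there (here x≡l₂)        = inj₂ (inj₁ x≡l₂)
  ... | there (there (here x≡v)) = inj₂ (inj₂ x≡v)

  config-exit : ∀ {x y} → InConfig C x → Edge G x y → ¬ InConfig C y → y ≡ v
  config-exit (inj₁ refl) xy _ = leaf-neighbour-unique G ℓ-leaf ℓv xy
  config-exit (inj₂ (inj₁ refl)) xy y∉C with b-neighbour xy
  ... | inj₁ refl        = ⊥-elim (y∉C l₁∈C)
  ... | inj₂ (inj₁ refl) = ⊥-elim (y∉C l₂∈C)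
  ... | inj₂ (inj₂ y≡v)  = y≡v
  config-exit (inj₂ (inj₂ (inj₁ refl))) xy y∉C with refl ← leaf-neighbour-unique G l₁-leaf (Edge-sym G bl₁) xy =
    ⊥-elim (y∉C b∈C)
  config-exit (inj₂ (inj₂ (inj₂ refl))) xy y∉C with refl ← leaf-neighbour-unique G l₂-leaf (Edge-sym G bl₂) xy =
    ⊥-elim (y∉C b∈C)

  Edge-e⁻ : ∀ {i j} → Edge G (e i) (e j) → Edge H i j
  Edge-e⁻ {i} {j} p = trans (e-adj i j) p

  Edge-e⁺ : ∀ {i j} → Edge H i j → Edge G (e i) (e j)
  Edge-e⁺ {i} {j} p = trans (sym (e-adj i j)) p

  preimage : ∀ x → ¬ InConfig C x → Fin (n H)
  preimage x x∉C = proj₁ (e-onto x x∉C)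

  e-preimage : ∀ {x} (x∉C : ¬ InConfig C x) → e (preimage x x∉C) ≡ x
  e-preimage {x} x∉C = proj₂ (e-onto x x∉C)

  iv : Fin (n H)
  iv = preimage v v∉C

  retract : Fin (n G) → Fin (n H)
  retract x with inConfig? x
  ... | yes _  = iv
  ... | no x∉C = preimage x x∉C

  retract-config : ∀ {x} → InConfig C x → retract x ≡ iv
  retract-config {x} x∈C with inConfig? x
  ... | yes _  = refl
  ... | no x∉C = ⊥-elim (x∉C x∈C)

  e-retract : ∀ {x} → ¬ InConfig C x → e (retract x) ≡ x
  e-retract {x} x∉C with inConfig? x
  ... | yes x∈C = ⊥-elim (x∉C x∈C)
  ... | no x∉C′ = e-preimage x∉C′

  retract-e : ∀ i → retract (e i) ≡ i
  retract-e i = e-inj (e-retract (e-out i))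

  retract-v : retract v ≡ iv
  retract-v = e-inj (trans (e-retract v∉C) (sym (e-preimage v∉C)))

  retract-Edge-outside : ∀ {x y} → ¬ InConfig C x → ¬ InConfig C y → Edge G x y → Edge H (retract x) (retract y)
  retract-Edge-outside x∉C y∉C xy = Edge-e⁻ (subst₂ (Edge G) (sym (e-retract x∉C)) (sym (e-retract y∉C)) xy)

  retract-Edge : ∀ {x y} → Edge G x y → retract x ≡ retract y ⊎ Edge H (retract x) (retract y)
  retract-Edge {x} {y} xy = by-cases (inConfig? x) (inConfig? y)
    where
    by-cases : Dec (InConfig C x) → Dec (InConfig C y) → retract x ≡ retract y ⊎ Edge H (retract x) (retract y)
    by-cases (yes x∈C) (yes y∈C) = inj₁ (trans (retract-config x∈C) (sym (retract-config y∈C)))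
    by-cases (yes x∈C) (no y∉C)  =
      inj₁ (trans (retract-config x∈C) (trans (sym retract-v) (cong retract (sym (config-exit x∈C xy y∉C)))))
    by-cases (no x∉C)  (yes y∈C) =
      inj₁ (trans (cong retract (config-exit y∈C (Edge-sym G xy) x∉C)) (trans retract-v (sym (retract-config y∈C))))
    by-cases (no x∉C)  (no y∉C)  = inj₂ (retract-Edge-outside x∉C y∉C xy)

  retract-Walk : ∀ {x y} → Walk G x y → Walk H (retract x) (retract y)
  retract-Walk here = here
  retract-Walk (step xy walk) with retract-Edge xy
  ... | inj₁ eq = subst (λ z → Walk H z _) (sym eq) (retract-Walk walk)
  ... | inj₂ e′ = step e′ (retract-Walk walk)

  removal-isTree : IsTree G → IsTree H
  removal-isTree (_ , connected , acyclic) = nonempty iv , connectedH , acyclicH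
    where
    nonempty : ∀ {m} → Fin m → 1 ≤ m
    nonempty Fin.zero    = s≤s z≤n
    nonempty (Fin.suc _) = s≤s z≤n

    connectedH : Connected H
    connectedH i j = subst₂ (Walk H) (retract-e i) (retract-e j) (retract-Walk (connected (e i) (e j)))

    acyclicH : Acyclic H
    acyclicH cycle = acyclic record
      { m = Cycle.m cycle ; c = e ∘ Cycle.c cycle ; inj = Cycle.inj cycle ∘ e-inj
      ; consec = Edge-e⁺ ∘ Cycle.consec cycle ; close = Edge-e⁺ (Cycle.close cycle) }

  ¬Edge-twigLeaf : ∀ {i l} → IsLeaf G l → Edge G b l → ¬ Edge G (e i) l
  ¬Edge-twigLeaf {i} l-leaf bl il =
    e-out i (subst (InConfig C) (sym (leaf-neighbour-unique G l-leaf (Edge-sym G bl) (Edge-sym G il))) b∈C)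

  image-neighbours-unique : ∀ i → Unique (map e (neighbours H i))
  image-neighbours-unique i = map⁺ᵘ e-inj (unique-neighbours H)

  ∈-image-neighbours⁻ : ∀ {i x} → x ∈ map e (neighbours H i) → Edge G (e i) x
  ∈-image-neighbours⁻ x∈ with k , k∈ , refl ← ∈-map⁻ e x∈ = Edge-e⁺ (∈-neighbours⁻ H k∈)

  ∈-image-neighbours⁺ : ∀ {i x} → Edge G (e i) x → ¬ InConfig C x → x ∈ map e (neighbours H i)
  ∈-image-neighbours⁺ {i} ix x∉C = subst (_∈ _) (e-retract x∉C)
    (∈-map⁺ e (∈-neighbours⁺ H (Edge-e⁻ (subst (Edge G (e i)) (sym (e-retract x∉C)) ix))))

  neighbours-away-from-v : ∀ {i} → e i ≢ v → neighbours G (e i) ↭ map e (neighbours H i)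
  neighbours-away-from-v {i} ei≢v = neighbours-↭ G (image-neighbours-unique i) ∈-image-neighbours⁻ complete
    where
    complete : ∀ {x} → Edge G (e i) x → x ∈ map e (neighbours H i)
    complete {x} ix with inConfig? x
    ... | yes x∈C = ⊥-elim (ei≢v (config-exit x∈C (Edge-sym G ix) (e-out i)))
    ... | no x∉C  = ∈-image-neighbours⁺ ix x∉C

  neighbours-at-v : ∀ {i} → e i ≡ v → neighbours G (e i) ↭ ℓ ∷ b ∷ map e (neighbours H i)
  neighbours-at-v {i} ei≡v = neighbours-↭ G
    ((ℓ≢b All.∷ All.tabulate (λ x∈ ℓ≡x → e-out′ x∈ (inj₁ (sym ℓ≡x))))
      ∷ All.tabulate (λ x∈ b≡x → e-out′ x∈ (inj₂ (inj₁ (sym b≡x)))) ∷ image-neighbours-unique i)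
    sound complete
    where
    e-out′ : ∀ {x} → x ∈ map e (neighbours H i) → ¬ InConfig C x
    e-out′ x∈ with k , _ , refl ← ∈-map⁻ e x∈ = e-out k

    sound : ∀ {x} → x ∈ ℓ ∷ b ∷ map e (neighbours H i) → Edge G (e i) x
    sound (here refl)         = subst (λ u → Edge G u ℓ) (sym ei≡v) (Edge-sym G ℓv)
    sound (there (here refl)) = subst (λ u → Edge G u b) (sym ei≡v) (Edge-sym G bv)
    sound (there (there x∈))  = ∈-image-neighbours⁻ x∈

    complete : ∀ {x} → Edge G (e i) x → x ∈ ℓ ∷ b ∷ map e (neighbours H i)
    complete {x} ix with inConfig? x
    ... | yes (inj₁ refl)               = here refl
    ... | yes (inj₂ (inj₁ refl))        = there (here refl)
    ... | yes (inj₂ (inj₂ (inj₁ refl))) = ⊥-elim (¬Edge-twigLeaf l₁-leaf bl₁ ix)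
    ... | yes (inj₂ (inj₂ (inj₂ refl))) = ⊥-elim (¬Edge-twigLeaf l₂-leaf bl₂ ix)
    ... | no x∉C                        = there (there (∈-image-neighbours⁺ ix x∉C))

  restrict : Colouring G → Colouring H
  restrict c = record { col = λ i j → col c (e i) (e j) ; csym = λ i j → csym c (e i) (e j) ∘ Edge-e⁺ }

  restrict-balanced : ∀ {c} → Balanced G c → Balanced H (restrict c)
  restrict-balanced {c} bal = balanced around
    where
    around : ∀ i → OneMoreBlue (map (col (restrict c) i) (neighbours H i))
    around i with e i ≟ v
    ... | no ei≢v  =
      subst OneMoreBlue (sym (map-∘ (neighbours H i))) (balanced-at bal (neighbours-away-from-v ei≢v))
    ... | yes ei≡v = subst OneMoreBlue (sym (map-∘ (neighbours H i))) (suc-injective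
        (subst₂ (λ k k′ → OneMoreBlue (k ∷ k′ ∷ map (col c (e i)) (map e (neighbours H i)))) ℓ-blue b-red
          (balanced-at bal (neighbours-at-v ei≡v))))
      where
      b-ei : Edge G b (e i)
      b-ei = subst (Edge G b) (sym ei≡v) bv

      ℓ-blue : col c (e i) ℓ ≡ blue
      ℓ-blue = edge-to-leaf-blue bal (subst (λ u → Edge G u ℓ) (sym ei≡v) (Edge-sym G ℓv)) ℓ-leaf

      b-red : col c (e i) b ≡ red
      b-red = trans (csym c _ _ (Edge-sym G b-ei))
        (twigBase-edge-red bal twigBase b-ei (e-out i ∘ inj₂ ∘ inj₂ ∘ inj₁) (e-out i ∘ inj₂ ∘ inj₂ ∘ inj₂))

-- Extending an ASBG-colouring across a removal

module Extension {G : Graph} {v : Fin (n G)} {C : LeafTwig G v} {H : Graph} (R : RemovalOf G C H) where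
  open LeafTwig C
  open RemovalOf R
  open Removal R

  module _ (d : Colouring H) where

    -- An edge leaving the configuration ends at v, and among the new edges only b–v is red.
    extendCol : Fin (n G) → Fin (n G) → Colour
    extendCol x y with inConfig? x | inConfig? y
    ... | no x∉C | no y∉C = col d (preimage x x∉C) (preimage y y∉C)
    ... | yes _  | no _   = if does (x ≟ b) then red else blue
    ... | no _   | yes _  = if does (y ≟ b) then red else blue
    ... | yes _  | yes _  = blue

    extendCol-sym : ∀ x y → Edge G x y → extendCol x y ≡ extendCol y x
    extendCol-sym x y xy with inConfig? x | inConfig? y
    ... | no x∉C | no y∉C =
      csym d _ _ (Edge-e⁻ (subst₂ (Edge G) (sym (e-preimage x∉C)) (sym (e-preimage y∉C)) xy))
    ... | yes _  | no _   = refl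
    ... | no _   | yes _  = refl
    ... | yes _  | yes _  = refl

    extended : Colouring G
    extended = record { col = extendCol ; csym = extendCol-sym }

    extendCol-e : ∀ j k → extendCol (e j) (e k) ≡ col d j k
    extendCol-e j k with inConfig? (e j) | inConfig? (e k)
    ... | no ej∉C | no ek∉C = cong₂ (col d) (e-inj (e-preimage ej∉C)) (e-inj (e-preimage ek∉C))
    ... | yes ej∈C | _      = ⊥-elim (e-out j ej∈C)
    ... | no _    | yes ek∈C = ⊥-elim (e-out k ek∈C)

    extendCol-exit : ∀ {x y} → InConfig C x → ¬ InConfig C y → extendCol x y ≡ (if does (x ≟ b) then red else blue)
    extendCol-exit {x} {y} x∈C y∉C with inConfig? x | inConfig? y
    ... | yes _  | no _    = refl
    ... | no x∉C | _       = ⊥-elim (x∉C x∈C)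
    ... | yes _  | yes y∈C = ⊥-elim (y∉C y∈C)

    extendCol-enter : ∀ {x y} → ¬ InConfig C x → InConfig C y → extendCol x y ≡ (if does (y ≟ b) then red else blue)
    extendCol-enter {x} {y} x∉C y∈C with inConfig? x | inConfig? y
    ... | no _    | yes _  = refl
    ... | yes x∈C | _      = ⊥-elim (x∉C x∈C)
    ... | no _    | no y∉C = ⊥-elim (y∉C y∈C)

    extendCol-inside : ∀ {x y} → InConfig C x → InConfig C y → extendCol x y ≡ blue
    extendCol-inside {x} {y} x∈C y∈C with inConfig? x | inConfig? y
    ... | yes _  | yes _  = refl
    ... | no x∉C | _      = ⊥-elim (x∉C x∈C)
    ... | yes _  | no y∉C = ⊥-elim (y∉C y∈C)

  module _ (πH : Permutation′ (n H)) where

    orderH : List (Fin (n H))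
    orderH = tabulate (πH ⟨$⟩ʳ_)

    orderM : List (Fin (n G))
    orderM = map e orderH

    -- b must meet its neighbours in the order l₁, v, l₂, and v must meet ℓ, b before its old neighbours.
    orderG : List (Fin (n G))
    orderG = l₁ ∷ ℓ ∷ b ∷ orderM ++ [ l₂ ]

    ∈-orderM : ∀ {x} → ¬ InConfig C x → x ∈ orderM
    ∈-orderM x∉C = subst (_∈ orderM) (e-preimage x∉C) (∈-map⁺ e (∈-tabulate-permutation πH _))

    orderM-outside : ∀ {x} → x ∈ orderM → ¬ InConfig C x
    orderM-outside x∈ with k , _ , refl ← ∈-map⁻ e x∈ = e-out k

    unique-orderM : Unique orderM
    unique-orderM = map⁺ᵘ e-inj (unique-tabulate-permutation πH)

    ∉-tail : ∀ {x} → InConfig C x → x ≢ l₂ → x ∉ orderM ++ [ l₂ ]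
    ∉-tail x∈C x≢l₂ x∈ with ∈-++⁻ orderM x∈
    ... | inj₁ x∈M         = orderM-outside x∈M x∈C
    ... | inj₂ (here x≡l₂) = x≢l₂ x≡l₂

    unique-orderG : Unique orderG
    unique-orderG =
      ∉⇒All≢ l₁∉ ∷ ∉⇒All≢ ℓ∉ ∷ ∉⇒All≢ (∉-tail b∈C b≢l₂) ∷ ++⁺ᵘ unique-orderM (All.[] ∷ []) disjoint
      where
      l₁∉ : l₁ ∉ ℓ ∷ b ∷ orderM ++ [ l₂ ]
      l₁∉ (here l₁≡ℓ)          = ℓ≢l₁ (sym l₁≡ℓ)
      l₁∉ (there (here l₁≡b))  = b≢l₁ (sym l₁≡b)
      l₁∉ (there (there l₁∈))  = ∉-tail l₁∈C l₁≢l₂ l₁∈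

      ℓ∉ : ℓ ∉ b ∷ orderM ++ [ l₂ ]
      ℓ∉ (here ℓ≡b) = ℓ≢b ℓ≡b
      ℓ∉ (there ℓ∈) = ∉-tail ℓ∈C ℓ≢l₂ ℓ∈

      disjoint : Disjoint orderM [ l₂ ]
      disjoint (l₂∈M , here refl) = orderM-outside l₂∈M l₂∈C

    complete-orderG : ∀ x → x ∈ orderG
    complete-orderG x with inConfig? x
    ... | yes (inj₁ refl)               = there (here refl)
    ... | yes (inj₂ (inj₁ refl))        = there (there (here refl))
    ... | yes (inj₂ (inj₂ (inj₁ refl))) = here refl
    ... | yes (inj₂ (inj₂ (inj₂ refl))) = there (there (there (∈-++⁺ʳ orderM (here refl))))
    ... | no x∉C                        = there (there (there (∈-++⁺ˡ (∈-orderM x∉C))))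

    private
      ordering = enumeration⇒permutation orderG unique-orderG complete-orderG

    πG : Permutation′ (n G)
    πG = proj₁ ordering

    neighboursIn-πG : ∀ u → neighboursIn G πG u ≡ filterᵇ (adj G u) orderG
    neighboursIn-πG u = cong (filterᵇ (adj G u)) (proj₂ ordering)

    ¬Edge-b-ℓ : ¬ Edge G b ℓ
    ¬Edge-b-ℓ bℓ = b≢v (leaf-neighbour-unique G ℓ-leaf ℓv (Edge-sym G bℓ))

    filter-orderM-b : filterᵇ (adj G b) orderM ≡ [ v ]
    filter-orderM-b = unique-singleton (filter⁺ _ unique-orderM) (∈-filterᵇ⁺ (∈-orderM v∉C) bv) only-v
      where
      only-v : ∀ {x} → x ∈ filterᵇ (adj G b) orderM → x ≡ v
      only-v x∈ with x∈M , bx ← ∈-filterᵇ⁻ orderM x∈ with b-neighbour bx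
      ... | inj₁ refl        = ⊥-elim (orderM-outside x∈M l₁∈C)
      ... | inj₂ (inj₁ refl) = ⊥-elim (orderM-outside x∈M l₂∈C)
      ... | inj₂ (inj₂ x≡v)  = x≡v

    filter-orderG-b : filterᵇ (adj G b) orderG ≡ l₁ ∷ v ∷ l₂ ∷ []
    filter-orderG-b = begin
      filterᵇ (adj G b) orderG                              ≡⟨ filterᵇ-accept (adj G b) _ bl₁ ⟩
      l₁ ∷ filterᵇ (adj G b) (ℓ ∷ b ∷ orderM ++ [ l₂ ])     ≡⟨ cong (l₁ ∷_) (filterᵇ-reject (adj G b) _ ¬Edge-b-ℓ) ⟩
      l₁ ∷ filterᵇ (adj G b) (b ∷ orderM ++ [ l₂ ])         ≡⟨ cong (l₁ ∷_) (filterᵇ-reject (adj G b) _ λ bb → Edge-irrefl G bb refl) ⟩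
      l₁ ∷ filterᵇ (adj G b) (orderM ++ [ l₂ ])             ≡⟨ cong (l₁ ∷_) (filter-++ (T? ∘ adj G b) orderM [ l₂ ]) ⟩
      l₁ ∷ filterᵇ (adj G b) orderM ++ filterᵇ (adj G b) [ l₂ ]
        ≡⟨ cong₂ (λ xs ys → l₁ ∷ xs ++ ys) filter-orderM-b (filterᵇ-accept (adj G b) [] bl₂) ⟩
      l₁ ∷ v ∷ l₂ ∷ []                                      ∎
      where open ≡-Reasoning

    filter-tail-e : ∀ j → filterᵇ (adj G (e j)) (orderM ++ [ l₂ ]) ≡ map e (filterᵇ (adj H j) orderH)
    filter-tail-e j = begin
      filterᵇ (adj G (e j)) (orderM ++ [ l₂ ])                        ≡⟨ filter-++ (T? ∘ adj G (e j)) orderM [ l₂ ] ⟩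
      filterᵇ (adj G (e j)) orderM ++ filterᵇ (adj G (e j)) [ l₂ ]    ≡⟨ cong₂ _++_ (filterᵇ-map e (sym ∘ e-adj j) orderH)
                                                                             (filterᵇ-reject (adj G (e j)) [] (¬Edge-twigLeaf l₂-leaf bl₂)) ⟩
      map e (filterᵇ (adj H j) orderH) ++ []                          ≡⟨ ++-identityʳ _ ⟩
      map e (filterᵇ (adj H j) orderH)                                ∎
      where open ≡-Reasoning

    filter-orderG-e-at-v : ∀ {j} → e j ≡ v → filterᵇ (adj G (e j)) orderG ≡ ℓ ∷ b ∷ map e (filterᵇ (adj H j) orderH)
    filter-orderG-e-at-v {j} ej≡v =
      trans (filterᵇ-reject (adj G (e j)) _ (¬Edge-twigLeaf l₁-leaf bl₁))
        (trans (filterᵇ-accept (adj G (e j)) _ (subst (λ u → Edge G u ℓ) (sym ej≡v) (Edge-sym G ℓv)))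
          (cong (ℓ ∷_) (trans (filterᵇ-accept (adj G (e j)) _ (subst (λ u → Edge G u b) (sym ej≡v) (Edge-sym G bv)))
            (cong (b ∷_) (filter-tail-e j)))))

    filter-orderG-e-away : ∀ {j} → e j ≢ v → filterᵇ (adj G (e j)) orderG ≡ map e (filterᵇ (adj H j) orderH)
    filter-orderG-e-away {j} ej≢v =
      trans (filterᵇ-reject (adj G (e j)) _ (¬Edge-twigLeaf l₁-leaf bl₁))
        (trans (filterᵇ-reject (adj G (e j)) _ (λ ejℓ → ej≢v (leaf-neighbour-unique G ℓ-leaf ℓv (Edge-sym G ejℓ))))
          (trans (filterᵇ-reject (adj G (e j)) _ ¬Edge-e-b) (filter-tail-e j)))
      where
      ¬Edge-e-b : ¬ Edge G (e j) b
      ¬Edge-e-b ejb with b-neighbour (Edge-sym G ejb)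
      ... | inj₁ ej≡l₁        = e-out j (subst (InConfig C) (sym ej≡l₁) l₁∈C)
      ... | inj₂ (inj₁ ej≡l₂) = e-out j (subst (InConfig C) (sym ej≡l₂) l₂∈C)
      ... | inj₂ (inj₂ ej≡v)  = ej≢v ej≡v

    module _ (d : Colouring H) (altH : ∀ j → AltBlue (map (col d j) (neighboursIn H πH j))) where

      private
        colours-image : ∀ j xs → map (extendCol d (e j)) (map e xs) ≡ map (col d j) xs
        colours-image j xs = trans (sym (map-∘ xs)) (map-cong (extendCol-e d j) xs)

        blue-singleton : ∀ {k} → k ≡ blue → AltBlue (k ∷ [])
        blue-singleton refl = single

        leaf-alternates : ∀ {x y} → IsLeaf G x → Edge G x y → extendCol d x y ≡ blue →
                          AltBlue (map (extendCol d x) (neighboursIn G πG x))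
        leaf-alternates x-leaf xy blue′ rewrite neighboursIn-leaf G πG x-leaf xy = blue-singleton blue′

      image-alternates : ∀ j → AltBlue (map (extendCol d (e j)) (neighboursIn G πG (e j)))
      image-alternates j with e j ≟ v
      ... | no ej≢v rewrite neighboursIn-πG (e j) | filter-orderG-e-away ej≢v | colours-image j (filterᵇ (adj H j) orderH) =
        altH j
      ... | yes ej≡v rewrite neighboursIn-πG (e j) | filter-orderG-e-at-v ej≡v | colours-image j (filterᵇ (adj H j) orderH)
                           | extendCol-enter d (e-out j) ℓ∈C | extendCol-enter d (e-out j) b∈C
                           | dec-false (ℓ ≟ b) ℓ≢b | dec-true (b ≟ b) refl =
        more (altH j)

      alternates : ∀ u → AltBlue (map (extendCol d u) (neighboursIn G πG u))
      alternates u = by-cases u (inConfig? u)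
        where
        by-cases : ∀ u → Dec (InConfig C u) → AltBlue (map (extendCol d u) (neighboursIn G πG u))
        by-cases _ (yes (inj₁ refl)) = leaf-alternates ℓ-leaf ℓv
          (trans (extendCol-exit d ℓ∈C v∉C) (cong (λ t → if t then red else blue) (dec-false (ℓ ≟ b) ℓ≢b)))
        by-cases _ (yes (inj₂ (inj₁ refl))) rewrite neighboursIn-πG b | filter-orderG-b
          | extendCol-inside d b∈C l₁∈C | extendCol-exit d b∈C v∉C
          | extendCol-inside d b∈C l₂∈C | dec-true (b ≟ b) refl = more single
        by-cases _ (yes (inj₂ (inj₂ (inj₁ refl)))) = leaf-alternates l₁-leaf (Edge-sym G bl₁) (extendCol-inside d l₁∈C b∈C)
        by-cases _ (yes (inj₂ (inj₂ (inj₂ refl)))) = leaf-alternates l₂-leaf (Edge-sym G bl₂) (extendCol-inside d l₂∈C b∈C)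
        by-cases u (no u∉C) =
          subst (λ x → AltBlue (map (extendCol d x) (neighboursIn G πG x))) (e-preimage u∉C) (image-alternates _)

  module _ (sideH : Fin (n H) → Bool) (bipartiteH : ∀ i j → Edge H i j → sideH i ≢ sideH j) where

    NextToV : Fin (n G) → Set
    NextToV x = x ≡ ℓ ⊎ x ≡ b

    nextToV? : Decidable NextToV
    nextToV? x = (x ≟ ℓ) ⊎-dec (x ≟ b)

    sideG : Fin (n G) → Bool
    sideG x = if does (nextToV? x) then not (sideH iv) else sideH (retract x)

    sideG-nextToV : ∀ {x} → NextToV x → sideG x ≡ not (sideH iv)
    sideG-nextToV {x} tx = cong (λ t → if t then not (sideH iv) else sideH (retract x)) (dec-true (nextToV? x) tx)

    sideG-notNextToV : ∀ {x} → ¬ NextToV x → sideG x ≡ sideH (retract x)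
    sideG-notNextToV {x} ¬tx = cong (λ t → if t then not (sideH iv) else sideH (retract x)) (dec-false (nextToV? x) ¬tx)

    nextToV-neighbour : ∀ {x y} → NextToV x → Edge G x y → ¬ NextToV y × retract y ≡ iv
    nextToV-neighbour (inj₁ refl) xy with refl ← leaf-neighbour-unique G ℓ-leaf ℓv xy =
      (λ { (inj₁ v≡ℓ) → ℓ≢v (sym v≡ℓ) ; (inj₂ v≡b) → b≢v (sym v≡b) }) , retract-v
    nextToV-neighbour (inj₂ refl) xy with b-neighbour xy
    ... | inj₁ refl        = (λ { (inj₁ l₁≡ℓ) → ℓ≢l₁ (sym l₁≡ℓ) ; (inj₂ l₁≡b) → b≢l₁ (sym l₁≡b) }) , retract-config l₁∈C
    ... | inj₂ (inj₁ refl) = (λ { (inj₁ l₂≡ℓ) → ℓ≢l₂ (sym l₂≡ℓ) ; (inj₂ l₂≡b) → b≢l₂ (sym l₂≡b) }) , retract-config l₂∈C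
    ... | inj₂ (inj₂ refl) = (λ { (inj₁ v≡ℓ) → ℓ≢v (sym v≡ℓ) ; (inj₂ v≡b) → b≢v (sym v≡b) }) , retract-v

    notNextToV-edge-outside : ∀ {x y} → ¬ NextToV x → ¬ NextToV y → Edge G x y → ¬ InConfig C x
    notNextToV-edge-outside ¬tx _ _ (inj₁ x≡ℓ) = ¬tx (inj₁ x≡ℓ)
    notNextToV-edge-outside ¬tx _ _ (inj₂ (inj₁ x≡b)) = ¬tx (inj₂ x≡b)
    notNextToV-edge-outside _ ¬ty xy (inj₂ (inj₂ (inj₁ refl))) = ¬ty (inj₂ (leaf-neighbour-unique G l₁-leaf (Edge-sym G bl₁) xy))
    notNextToV-edge-outside _ ¬ty xy (inj₂ (inj₂ (inj₂ refl))) = ¬ty (inj₂ (leaf-neighbour-unique G l₂-leaf (Edge-sym G bl₂) xy))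

    nextToV-edge-sides : ∀ {x y} → NextToV x → Edge G x y → sideG x ≢ sideG y
    nextToV-edge-sides tx xy eq = let ¬ty , y↦iv = nextToV-neighbour tx xy in
      not-¬ refl (sym (trans (sym (sideG-nextToV tx)) (trans eq (trans (sideG-notNextToV ¬ty) (cong sideH y↦iv)))))

    bipartiteG : ∀ x y → Edge G x y → sideG x ≢ sideG y
    bipartiteG x y xy = by-cases (nextToV? x) (nextToV? y)
      where
      by-cases : Dec (NextToV x) → Dec (NextToV y) → sideG x ≢ sideG y
      by-cases (yes tx) _        = nextToV-edge-sides tx xy
      by-cases (no _)   (yes ty) = nextToV-edge-sides ty (Edge-sym G xy) ∘ sym
      by-cases (no ¬tx) (no ¬ty) eq = bipartiteH _ _
        (retract-Edge-outside (notNextToV-edge-outside ¬tx ¬ty xy) (notNextToV-edge-outside ¬ty ¬tx (Edge-sym G xy)) xy)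
        (trans (sym (sideG-notNextToV ¬tx)) (trans eq (sideG-notNextToV ¬ty)))

  extend : HasASBGColouring H → HasASBGColouring G
  extend (d , (sideH , bipartiteH) , _ , πH , altH) =
    extended d , (sideG sideH bipartiteH , bipartiteG sideH bipartiteH) ,
    balanced⇒neighbour (alternating⇒balanced G (extended d) (πG πH) alt) , πG πH , alt
    where
    alt = alternates πH d altH

module _ (R : Graph) (iso : R ≅ P₂) where
  open _≅_ iso

  private
    to = Inverse.to f
    from = Inverse.from f

    P₂-edge⇒opposite : ∀ i j → P₂adj i j ≡ true → j ≡ opposite i
    P₂-edge⇒opposite Fin.zero (Fin.suc Fin.zero) _ = refl
    P₂-edge⇒opposite (Fin.suc Fin.zero) Fin.zero _ = refl
    P₂-edge⇒opposite Fin.zero Fin.zero ()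
    P₂-edge⇒opposite (Fin.suc Fin.zero) (Fin.suc Fin.zero) ()

    P₂-edge-opposite : ∀ i → P₂adj i (opposite i) ≡ true
    P₂-edge-opposite Fin.zero = refl
    P₂-edge-opposite (Fin.suc Fin.zero) = refl

    isZero : Fin 2 → Bool
    isZero Fin.zero    = true
    isZero (Fin.suc _) = false

    isZero-opposite : ∀ i → isZero i ≢ isZero (opposite i)
    isZero-opposite Fin.zero ()
    isZero-opposite (Fin.suc Fin.zero) ()

    partner : Fin (n R) → Fin (n R)
    partner u = from (opposite (to u))

    Edge⇒partner : ∀ {u x} → Edge R u x → x ≡ partner u
    Edge⇒partner {u} {x} ux = trans (sym (Inverse.strictlyInverseʳ f x))
      (cong from (P₂-edge⇒opposite (to u) (to x) (trans (sym (f-adj u x)) ux)))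

    Edge-partner : ∀ u → Edge R u (partner u)
    Edge-partner u = trans (f-adj u (partner u))
      (subst (λ j → P₂adj (to u) j ≡ true) (sym (Inverse.strictlyInverseˡ f _)) (P₂-edge-opposite (to u)))

    neighboursIn-partner : ∀ u → neighboursIn R Perm.id u ≡ [ partner u ]
    neighboursIn-partner u =
      unique-singleton (unique-neighboursIn R Perm.id) (∈-neighboursIn⁺ R Perm.id (Edge-partner u))
      (Edge⇒partner ∘ ∈-neighboursIn⁻ R Perm.id)

    allBlue : Colouring R
    allBlue = record { col = λ _ _ → blue ; csym = λ _ _ _ → refl }

    alternates : ∀ u → AltBlue (map (col allBlue u) (neighboursIn R Perm.id u))
    alternates u rewrite neighboursIn-partner u = single

    bipartite : ∀ u x → Edge R u x → isZero (to u) ≢ isZero (to x)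
    bipartite u x ux rewrite Edge⇒partner ux | Inverse.strictlyInverseˡ f (opposite (to u)) = isZero-opposite (to u)

  ≅P₂⇒ASBG : HasASBGColouring R
  ≅P₂⇒ASBG = allBlue , (isZero ∘ to , bipartite) , (λ u → partner u , Edge-partner u) , Perm.id , alternates

balanced-along-reduction : ∀ {G R} → Star RemoveStep G R → IsTree G → ∀ {c} → Balanced G c →
                           Σ[ cR ∈ Colouring R ] IsTree R × Balanced R cR
balanced-along-reduction ε tree bal = _ , tree , bal
balanced-along-reduction ((_ , _ , removal) ◅ steps) tree bal =
  balanced-along-reduction steps (Removal.removal-isTree removal tree) (Removal.restrict-balanced removal bal)

ASBG-against-reduction : ∀ {G R} → Star RemoveStep G R → HasASBGColouring R → HasASBGColouring G
ASBG-against-reduction ε asbg = asbg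
ASBG-against-reduction ((_ , _ , removal) ◅ steps) asbg = Extension.extend removal (ASBG-against-reduction steps asbg)

balanced-reduced-tree≅P₂ : ∀ {G c} → IsTree G → Balanced G c → HasNoLeafTwig G → G ≅ P₂
balanced-reduced-tree≅P₂ {G} (1≤n , connected , acyclic) bal noLeafTwig =
  all-leaves⇒≅P₂ G connected (all-leaves bal noLeafTwig acyclic) (fromℕ< 1≤n)

mainTheorem4 : (T : Graph) → IsTree T →
    ((R : Graph) → IsReducedForm T R → (HasASBGColouring T ⇔ (R ≅ P₂)))
    × ((c c′ : Colouring T) → IsASBGColouring T c → IsASBGColouring T c′ →
        ∀ u v → Edge T u v → col c u v ≡ col c′ u v)
mainTheorem4 T tree@(_ , _ , acyclic) = reduced-form , uniqueness
  where
  reduced-form : (R : Graph) → IsReducedForm T R → HasASBGColouring T ⇔ (R ≅ P₂)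
  reduced-form R (steps , reduced) = mk⇔
    (λ (c , asbg) → let _ , treeR , balR = balanced-along-reduction steps tree (ASBG⇒Balanced T c asbg) in
                    balanced-reduced-tree≅P₂ treeR balR reduced)
    (ASBG-against-reduction steps ∘ ≅P₂⇒ASBG R)

  uniqueness : (c c′ : Colouring T) → IsASBGColouring T c → IsASBGColouring T c′ →
               ∀ u v → Edge T u v → col c u v ≡ col c′ u v
  uniqueness c c′ asbg asbg′ =
    balanced-colourings-agree T acyclic c c′ (ASBG⇒Balanced T c asbg) (ASBG⇒Balanced T c′ asbg′)
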